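{- Let $X=\{0,1\}$ and let $a,b$ be the automorphisms of the binary rooted tree $X^*$ defined recursively by $a(0w)=1\,a(w)$, $a(1w)=0\,w$, $b(0w)=0\,b(w)$, $b(1w)=1\,a(w)$ (i.e. $a=(0\,1)(a,\mathds{1})$, $b=(b,a)$), and let $G=\langle a,b\rangle$. For $m\ge1$ let $\Gamma_m$ be the Schreier graph of $G$ on $X^m$ with respect to $\{a,b\}$. Then: (1) if $m>n\ge1$, $\Gamma_m$ is an unramified covering of $\Gamma_n$ (via the map forgetting the last $m-n$ letters); (2) for every $n\ge1$, $\Gamma_{n+1}$ is a Galois covering of $\Gamma_n$ with Galois group $\mathrm{Gal}(\Gamma_{n+1}|\Gamma_n)\simeq\mathbb{Z}/2\mathbb{Z}$.
   Context: The Schreier graph $\Gamma_m$ has vertex set $X^m$ and, for each generator $s\in\{a,b\}$ and vertex $w$, an edge joining $w$ and $s(w)$ (loops and multiple edges allowed). An unramified covering $\pi:\widetilde Y\to Y$ is an onto graph map mapping the neighbours of each vertex of $\widetilde Y$ bijectively onto the neighbours of its image; if all fibres have $k$ elements it is $k$-sheeted, and it is Galois (normal) if there are $k$ graph automorphisms $\sigma$ of $\widetilde Y$ with $\pi\circ\sigma=\pi$, which form the Galois group. -}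

module Defs where

open import Data.Bool using (Bool; true; false; not; _xor_)
open import Data.Nat using (ℕ; zero; suc; _≤_; z≤n; s≤s)
open import Data.Fin using (Fin)
open import Data.Vec using (Vec; []; _∷_)
open import Data.Product using (Σ; ∃; _×_; _,_)
open import Relation.Binary.PropositionalEquality using (_≡_; _≢_; refl)
open import Function.Bundles using (_↔_)

-- The automaton group G = ⟨a , b⟩ acting on X^m, X = {0,1}
-- (0 = false, 1 = true)

a : ∀ {m} → Vec Bool m → Vec Bool m
a []            = []
a (false ∷ w)   = true ∷ a w
a (true  ∷ w)   = false ∷ w

b : ∀ {m} → Vec Bool m → Vec Bool m
b []            = []
b (false ∷ w)   = false ∷ b w
b (true  ∷ w)   = true ∷ a w

data Gen : Set where
  ga gb : Gen

act : ∀ {m} → Gen → Vec Bool m → Vec Bool m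
act ga = a
act gb = b

-- Multigraphs with loops and multiple edges, in Serre's formalism:
-- every (undirected) edge consists of two darts (half-edges) d, rev d;
-- src d is the vertex at which d starts.  A loop at v gives two darts
-- starting at v.

record Graph : Set₁ where
  field
    V         : Set
    D         : Set
    src       : D → V
    rev       : D → D
    rev-invol : ∀ d → rev (rev d) ≡ d
    rev-nofix : ∀ d → rev d ≢ d

open Graph public

record Hom (G H : Graph) : Set where
  field
    fV       : V G → V H
    fD       : D G → D H
    src-comm : ∀ d → src H (fD d) ≡ fV (src G d)
    rev-comm : ∀ d → fD (rev G d) ≡ rev H (fD d)

open Hom public

idHom : (G : Graph) → Hom G G
idHom G = record
  { fV = λ v → v ; fD = λ d → d
  ; src-comm = λ d → Relation.Binary.PropositionalEquality.refl
  ; rev-comm = λ d → Relation.Binary.PropositionalEquality.refl }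

_∘H_ : ∀ {G H K} → Hom H K → Hom G H → Hom G K
_∘H_ {G} {H} {K} g f = record
  { fV = λ v → fV g (fV f v)
  ; fD = λ d → fD g (fD f d)
  ; src-comm = λ d → trans (src-comm g (fD f d)) (cong (fV g) (src-comm f d))
  ; rev-comm = λ d → trans (cong (fD g) (rev-comm f d)) (rev-comm g (fD f d)) }
  where open Relation.Binary.PropositionalEquality using (trans; cong)

_≈H_ : ∀ {G H} → Hom G H → Hom G H → Set
f ≈H g = (∀ v → fV f v ≡ fV g v) × (∀ d → fD f d ≡ fD g d)

IsAuto : ∀ {G} → Hom G G → Set
IsAuto {G} σ = Σ (Hom G G) λ τ → ((τ ∘H σ) ≈H idHom G) × ((σ ∘H τ) ≈H idHom G)

-- for every vertex v, the darts starting at v are mapped bijectively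
-- onto the darts starting at fV v  (neighbours counted with multiplicity)
LocallyBijective : ∀ {G H} → Hom G H → Set
LocallyBijective {G} {H} f =
  ∀ v →
    (∀ d d' → src G d ≡ v → src G d' ≡ v → fD f d ≡ fD f d' → d ≡ d')
  × (∀ e → src H e ≡ fV f v → ∃ λ d → src G d ≡ v × fD f d ≡ e)

IsCovering : ∀ {G H} → Hom G H → Set
IsCovering {G} {H} f =
  (∀ u → ∃ λ v → fV f v ≡ u)
  × LocallyBijective f

Fibre : ∀ {G H} → Hom G H → V H → Set
Fibre {G} f u = Σ (V G) λ v → fV f v ≡ u

HasSheets : ∀ {G H} → ℕ → Hom G H → Set
HasSheets k f = ∀ u → Fin k ↔ Fibre f u

Deck : ∀ {G H} → Hom G H → Set
Deck {G} π = Σ (Hom G G) λ σ → IsAuto σ × ((π ∘H σ) ≈H π)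

DeckEq : ∀ {G H} (π : Hom G H) → Deck π → Deck π → Set
DeckEq π (σ , _) (τ , _) = σ ≈H τ

HasKDeck : ∀ {G H} → ℕ → Hom G H → Set
HasKDeck k π = Σ (Fin k → Deck π) λ σs →
    (∀ i j → DeckEq π (σs i) (σs j) → i ≡ j)
  × (∀ τ → ∃ λ i → DeckEq π τ (σs i))

IsGalois : ∀ {G H} → ℕ → Hom G H → Set
IsGalois k π = IsCovering π × HasSheets k π × HasKDeck k π

-- Gal(π) ≅ ℤ/2ℤ: a group isomorphism from (Bool, xor) onto the deck group
GalIsoZ2 : ∀ {G H} → Hom G H → Set
GalIsoZ2 π = Σ (Bool → Deck π) λ φ →
    (∀ i j → DeckEq π (φ i) (φ j) → i ≡ j)
  × (∀ τ → ∃ λ i → DeckEq π τ (φ i))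
  × (∀ i j → (Data.Product.proj₁ (φ (i xor j)))
               ≈H (Data.Product.proj₁ (φ i) ∘H Data.Product.proj₁ (φ j)))

-- The Schreier graph Γ_m: vertices X^m, one edge {w , s w} for each
-- generator s and vertex w.  Dart (s , w , true) goes from w to s w,
-- dart (s , w , false) is its reverse, going from s w to w.

SD : ℕ → Set
SD m = Gen × Vec Bool m × Bool

ssrc : ∀ {m} → SD m → Vec Bool m
ssrc (s , w , true)  = w
ssrc (s , w , false) = act s w

srev : ∀ {m} → SD m → SD m
srev (s , w , o) = (s , w , not o)

srev-invol : ∀ {m} (d : SD m) → srev (srev d) ≡ d
srev-invol (s , w , true)  = refl
srev-invol (s , w , false) = refl

srev-nofix : ∀ {m} (d : SD m) → srev d ≢ d
srev-nofix (s , w , true)  ()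
srev-nofix (s , w , false) ()

Schreier : ℕ → Graph
Schreier m = record
  { V = Vec Bool m ; D = SD m ; src = ssrc ; rev = srev
  ; rev-invol = srev-invol ; rev-nofix = srev-nofix }

prefix : ∀ {A : Set} {m n} → n ≤ m → Vec A m → Vec A n
prefix z≤n       _        = []
prefix (s≤s p) (x ∷ xs)   = x ∷ prefix p xs

-- Forgetting letters commutes with a and b, and a dart of a Schreier graph is determined by
-- its start, generator and orientation; so every equivariant map between Schreier graphs of
-- the bijections a, b is a local bijection on darts, and the prefix maps are coverings.
-- A deck transformation of Γ_{n+1} → Γ_n preserves these labels, hence commutes with a.
-- As a acts transitively on X^{n+1} (it is an odometer), such a map is fixed by the image
-- of 0^{n+1}, which lies in the two-element fibre {0^{n+1}, 0^n 1}.  Both choices occur: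
-- the sections of a and b at level n act on the last letter as the identity or as the swap,
-- so flipping the last letter commutes with a and b.  The deck group is thus {id, flip} ≅ ℤ/2ℤ.
module Submission where

open import Defs
open import Data.Nat using (ℕ; suc; _≤_; _<_; s≤s; z≤n)
open import Data.Nat.Properties using (<⇒≤; n≤1+n)
open import Data.Product using (Σ; _×_)
open import Relation.Binary.PropositionalEquality using (_≡_)

open import Data.Nat using (zero)
open import Data.Bool using (Bool; true; false; not; _xor_; if_then_else_)
open import Data.Fin.Properties using (2↔Bool)
open import Data.Product using (∃; _,_; proj₁; proj₂)
open import Data.Vec using (Vec; []; _∷_; _∷ʳ_; last; replicate)
open import Data.Vec.Properties using (∷-injective; ∷-injectiveʳ; last-∷ʳ)
open import Function.Bundles using (_↔_; mk↔ₛ′; module Inverse)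
open import Function.Construct.Composition using (_↔-∘_)
open import Relation.Binary.Construct.Closure.ReflexiveTransitive using (Star; ε; _◅_; _◅◅_)
open import Relation.Binary.PropositionalEquality using (_≢_; refl; sym; trans; cong; subst; module ≡-Reasoning)

zeros : ∀ m → Vec Bool m
zeros m = replicate m false

a⁻¹ : ∀ {m} → Vec Bool m → Vec Bool m
a⁻¹ []          = []
a⁻¹ (false ∷ w) = true ∷ w
a⁻¹ (true ∷ w)  = false ∷ a⁻¹ w

b⁻¹ : ∀ {m} → Vec Bool m → Vec Bool m
b⁻¹ []          = []
b⁻¹ (false ∷ w) = false ∷ b⁻¹ w
b⁻¹ (true ∷ w)  = true ∷ a⁻¹ w

a∘a⁻¹ : ∀ {m} (w : Vec Bool m) → a (a⁻¹ w) ≡ w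
a∘a⁻¹ []          = refl
a∘a⁻¹ (false ∷ w) = refl
a∘a⁻¹ (true ∷ w)  = cong (true ∷_) (a∘a⁻¹ w)

a⁻¹∘a : ∀ {m} (w : Vec Bool m) → a⁻¹ (a w) ≡ w
a⁻¹∘a []          = refl
a⁻¹∘a (false ∷ w) = cong (false ∷_) (a⁻¹∘a w)
a⁻¹∘a (true ∷ w)  = refl

b∘b⁻¹ : ∀ {m} (w : Vec Bool m) → b (b⁻¹ w) ≡ w
b∘b⁻¹ []          = refl
b∘b⁻¹ (false ∷ w) = cong (false ∷_) (b∘b⁻¹ w)
b∘b⁻¹ (true ∷ w)  = cong (true ∷_) (a∘a⁻¹ w)

b⁻¹∘b : ∀ {m} (w : Vec Bool m) → b⁻¹ (b w) ≡ w
b⁻¹∘b []          = refl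
b⁻¹∘b (false ∷ w) = cong (false ∷_) (b⁻¹∘b w)
b⁻¹∘b (true ∷ w)  = cong (true ∷_) (a⁻¹∘a w)

act⁻¹ : ∀ {m} → Gen → Vec Bool m → Vec Bool m
act⁻¹ ga = a⁻¹
act⁻¹ gb = b⁻¹

act∘act⁻¹ : ∀ {m} s (w : Vec Bool m) → act s (act⁻¹ s w) ≡ w
act∘act⁻¹ ga = a∘a⁻¹
act∘act⁻¹ gb = b∘b⁻¹

act⁻¹∘act : ∀ {m} s (w : Vec Bool m) → act⁻¹ s (act s w) ≡ w
act⁻¹∘act ga = a⁻¹∘a
act⁻¹∘act gb = b⁻¹∘b

act-injective : ∀ {m} s {v w : Vec Bool m} → act s v ≡ act s w → v ≡ w
act-injective s {v} {w} e = begin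
  v                    ≡⟨ sym (act⁻¹∘act s v) ⟩
  act⁻¹ s (act s v)    ≡⟨ cong (act⁻¹ s) e ⟩
  act⁻¹ s (act s w)    ≡⟨ act⁻¹∘act s w ⟩
  w                    ∎
  where open ≡-Reasoning

Equivariant : ∀ {m n} → (Vec Bool m → Vec Bool n) → Set
Equivariant f = ∀ s w → f (act s w) ≡ act s (f w)

gen : ∀ {m} → SD m → Gen
gen = proj₁

base : ∀ {m} → SD m → Vec Bool m
base d = proj₁ (proj₂ d)

orient : ∀ {m} → SD m → Bool
orient d = proj₂ (proj₂ d)

dart-unique : ∀ {m} (d d' : SD m) →
  gen d ≡ gen d' → orient d ≡ orient d' → ssrc d ≡ ssrc d' → d ≡ d'
dart-unique (s , v , true)  (.s , .v , true)  refl refl refl = refl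
dart-unique (s , v , false) (.s , w  , false) refl refl e    =
  cong (λ u → s , u , false) (act-injective s e)

-- Written with projections so that gen (mapDart f d) and orient (mapDart f d) reduce to
-- gen d and orient d for every d.
mapDart : ∀ {m n} → (Vec Bool m → Vec Bool n) → SD m → SD n
mapDart f d = gen d , f (base d) , orient d

schreierHom : ∀ {m n} (f : Vec Bool m → Vec Bool n) → Equivariant f →
  Hom (Schreier m) (Schreier n)
schreierHom f f-eq = record
  { fV = f ; fD = mapDart f ; src-comm = mapDart-src ; rev-comm = λ _ → refl }
  where
  mapDart-src : ∀ d → ssrc (mapDart f d) ≡ f (ssrc d)
  mapDart-src (s , w , true)  = refl
  mapDart-src (s , w , false) = sym (f-eq s w)

schreierHom-locallyBijective : ∀ {m n} (f : Vec Bool m → Vec Bool n) (f-eq : Equivariant f) →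
  LocallyBijective (schreierHom f f-eq)
schreierHom-locallyBijective f f-eq v = injective , surjective
  where
  injective : ∀ d d' → ssrc d ≡ v → ssrc d' ≡ v → mapDart f d ≡ mapDart f d' → d ≡ d'
  injective d d' e e' eq =
    dart-unique d d' (cong gen eq) (cong orient eq) (trans e (sym e'))

  dartAt : Gen → Bool → SD _
  dartAt s o = s , (if o then v else act⁻¹ s v) , o

  ssrc-dartAt : ∀ s o → ssrc (dartAt s o) ≡ v
  ssrc-dartAt s true  = refl
  ssrc-dartAt s false = act∘act⁻¹ s v

  surjective : ∀ e → ssrc e ≡ f v → ∃ λ d → ssrc d ≡ v × mapDart f d ≡ e
  surjective e e-src = d , ssrc-dartAt (gen e) (orient e) ,
    dart-unique (mapDart f d) e refl refl
      (trans (src-comm (schreierHom f f-eq) d) (trans (cong f (ssrc-dartAt (gen e) (orient e))) (sym e-src)))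
    where
    d : SD _
    d = dartAt (gen e) (orient e)

schreierHom-isCovering : ∀ {m n} (f : Vec Bool m → Vec Bool n) (f-eq : Equivariant f) →
  (∀ u → ∃ λ v → f v ≡ u) → IsCovering (schreierHom f f-eq)
schreierHom-isCovering f f-eq f-onto = f-onto , schreierHom-locallyBijective f f-eq

LabelPreserving : ∀ {m n} → Hom (Schreier m) (Schreier n) → Set
LabelPreserving σ = ∀ d → fD σ d ≡ mapDart (fV σ) d

≈H-fromVertices : ∀ {m n} (σ τ : Hom (Schreier m) (Schreier n)) →
  LabelPreserving σ → LabelPreserving τ → (∀ v → fV σ v ≡ fV τ v) → σ ≈H τ
≈H-fromVertices σ τ σ-lp τ-lp eqV = eqV , λ d →
  trans (σ-lp d) (trans (cong (λ u → gen d , u , orient d) (eqV (base d))) (sym (τ-lp d)))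

labelPreserving-equivariant : ∀ {m n} (σ : Hom (Schreier m) (Schreier n)) →
  LabelPreserving σ → Equivariant (fV σ)
labelPreserving-equivariant σ σ-lp s w =
  trans (sym (src-comm σ (s , w , false))) (cong ssrc (σ-lp (s , w , false)))

over-labelPreserving : ∀ {m n} (f : Vec Bool m → Vec Bool n) (f-eq : Equivariant f)
  (σ : Hom (Schreier m) (Schreier m)) → (schreierHom f f-eq ∘H σ) ≈H schreierHom f f-eq →
  LabelPreserving σ
over-labelPreserving f f-eq σ (_ , over) (s , w , true) =
  dart-unique (fD σ d) (mapDart (fV σ) d) (cong gen (over d)) (cong orient (over d)) (src-comm σ d)
  where
  d : SD _
  d = s , w , true
over-labelPreserving f f-eq σ over (s , w , false) =
  trans (rev-comm σ (s , w , true)) (cong srev (over-labelPreserving f f-eq σ over (s , w , true)))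

involution-isAuto : ∀ {m} (f : Vec Bool m → Vec Bool m) (f-eq : Equivariant f) →
  (∀ w → f (f w) ≡ w) → IsAuto (schreierHom f f-eq)
involution-isAuto f f-eq f-invol = schreierHom f f-eq , f∘f≈id , f∘f≈id
  where
  f∘f≈id : (schreierHom f f-eq ∘H schreierHom f f-eq) ≈H idHom _
  f∘f≈id = ≈H-fromVertices (schreierHom f f-eq ∘H schreierHom f f-eq) (idHom _)
    (λ _ → refl) (λ _ → refl) f-invol

a²-∷ : ∀ {m} x (w : Vec Bool m) → a (a (x ∷ w)) ≡ x ∷ a w
a²-∷ false w = refl
a²-∷ true  w = refl

_↝ᵃ_ : ∀ {m} → Vec Bool m → Vec Bool m → Set
_↝ᵃ_ = Star (λ u v → a u ≡ v)

↝ᵃ-∷ : ∀ {m} x {u v : Vec Bool m} → u ↝ᵃ v → (x ∷ u) ↝ᵃ (x ∷ v)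
↝ᵃ-∷ x ε               = ε
↝ᵃ-∷ x {u} (refl ◅ u↝v) = refl ◅ a²-∷ x u ◅ ↝ᵃ-∷ x u↝v

zeros-↝ᵃ : ∀ {m} (w : Vec Bool m) → zeros m ↝ᵃ w
zeros-↝ᵃ []          = ε
zeros-↝ᵃ (false ∷ w) = ↝ᵃ-∷ false (zeros-↝ᵃ w)
zeros-↝ᵃ (true ∷ w)  = ↝ᵃ-∷ false (zeros-↝ᵃ (a⁻¹ w)) ◅◅ (cong (true ∷_) (a∘a⁻¹ w) ◅ ε)

equivariant-unique : ∀ {m n} (f g : Vec Bool m → Vec Bool n) →
  Equivariant f → Equivariant g → f (zeros m) ≡ g (zeros m) → ∀ w → f w ≡ g w
equivariant-unique f g f-eq g-eq f≡g w = along (zeros-↝ᵃ w) f≡g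
  where
  along : ∀ {u v} → u ↝ᵃ v → f u ≡ g u → f v ≡ g v
  along ε               fu≡gu = fu≡gu
  along {u} (refl ◅ u↝v) fu≡gu = along u↝v (begin
    f (a u)   ≡⟨ f-eq ga u ⟩
    a (f u)   ≡⟨ cong a fu≡gu ⟩
    a (g u)   ≡⟨ sym (g-eq ga u) ⟩
    g (a u)   ∎)
    where open ≡-Reasoning

prefix-a : ∀ {m n} (p : n ≤ m) (w : Vec Bool m) → prefix p (a w) ≡ a (prefix p w)
prefix-a z≤n     w           = refl
prefix-a (s≤s p) (false ∷ w) = cong (true ∷_) (prefix-a p w)
prefix-a (s≤s p) (true ∷ w)  = refl

prefix-b : ∀ {m n} (p : n ≤ m) (w : Vec Bool m) → prefix p (b w) ≡ b (prefix p w)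
prefix-b z≤n     w           = refl
prefix-b (s≤s p) (false ∷ w) = cong (false ∷_) (prefix-b p w)
prefix-b (s≤s p) (true ∷ w)  = cong (true ∷_) (prefix-a p w)

prefix-equivariant : ∀ {m n} (p : n ≤ m) → Equivariant (prefix p)
prefix-equivariant p ga = prefix-a p
prefix-equivariant p gb = prefix-b p

padWith : ∀ {A : Set} {m n} → A → n ≤ m → Vec A n → Vec A m
padWith {m = m} x z≤n     []       = replicate m x
padWith         x (s≤s p) (y ∷ u)  = y ∷ padWith x p u

prefix-padWith : ∀ {A : Set} {m n} (x : A) (p : n ≤ m) (u : Vec A n) → prefix p (padWith x p u) ≡ u
prefix-padWith x z≤n     []      = refl
prefix-padWith x (s≤s p) (y ∷ u) = cong (y ∷_) (prefix-padWith x p u)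

prefix-∷ʳ : ∀ {A : Set} {n} (p : n ≤ suc n) (u : Vec A n) x → prefix p (u ∷ʳ x) ≡ u
prefix-∷ʳ z≤n     []      x = refl
prefix-∷ʳ (s≤s p) (y ∷ u) x = cong (y ∷_) (prefix-∷ʳ p u x)

prefix-∷ʳ-last : ∀ {A : Set} {n} (p : n ≤ suc n) (w : Vec A (suc n)) → prefix p w ∷ʳ last w ≡ w
prefix-∷ʳ-last z≤n     (x ∷ []) = refl
prefix-∷ʳ-last (s≤s p) (x ∷ w)  = cong (x ∷_) (prefix-∷ʳ-last p w)

prefixHom : ∀ {m n} → n ≤ m → Hom (Schreier m) (Schreier n)
prefixHom p = schreierHom (prefix p) (prefix-equivariant p)

prefixHom-isCovering : ∀ {m n} (p : n ≤ m) → IsCovering (prefixHom p)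
prefixHom-isCovering p =
  schreierHom-isCovering (prefix p) (prefix-equivariant p) λ u → padWith false p u , prefix-padWith false p u

fibre-≡ : ∀ {G H} {π : Hom G H} {u} {x y : Fibre π u} → proj₁ x ≡ proj₁ y → x ≡ y
fibre-≡ {x = v , refl} {.v , refl} refl = refl

prefixHom-fibre↔Bool : ∀ {n} (p : n ≤ suc n) u → Bool ↔ Fibre (prefixHom p) u
prefixHom-fibre↔Bool p u = mk↔ₛ′ extend (λ (v , _) → last v) extend∘last (λ x → last-∷ʳ x u)
  where
  extend : Bool → Fibre (prefixHom p) u
  extend x = u ∷ʳ x , prefix-∷ʳ p u x

  extend∘last : ∀ v → extend (last (proj₁ v)) ≡ v
  extend∘last (v , refl) = fibre-≡ {π = prefixHom p} (prefix-∷ʳ-last p v)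

prefixHom-hasSheets₂ : ∀ {n} (p : n ≤ suc n) → HasSheets 2 (prefixHom p)
prefixHom-hasSheets₂ p u = prefixHom-fibre↔Bool p u ↔-∘ 2↔Bool

flipLast : ∀ {m} → Vec Bool (suc m) → Vec Bool (suc m)
flipLast {zero}  (x ∷ []) = not x ∷ []
flipLast {suc m} (x ∷ w)  = x ∷ flipLast w

flipLast-a : ∀ {m} (w : Vec Bool (suc m)) → flipLast (a w) ≡ a (flipLast w)
flipLast-a {zero}  (false ∷ []) = refl
flipLast-a {zero}  (true ∷ [])  = refl
flipLast-a {suc m} (false ∷ w)  = cong (true ∷_) (flipLast-a w)
flipLast-a {suc m} (true ∷ w)   = refl

flipLast-b : ∀ {m} (w : Vec Bool (suc m)) → flipLast (b w) ≡ b (flipLast w)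
flipLast-b {zero}  (false ∷ []) = refl
flipLast-b {zero}  (true ∷ [])  = refl
flipLast-b {suc m} (false ∷ w)  = cong (false ∷_) (flipLast-b w)
flipLast-b {suc m} (true ∷ w)   = cong (true ∷_) (flipLast-a w)

flipLast-involutive : ∀ {m} (w : Vec Bool (suc m)) → flipLast (flipLast w) ≡ w
flipLast-involutive {zero}  (false ∷ []) = refl
flipLast-involutive {zero}  (true ∷ [])  = refl
flipLast-involutive {suc m} (x ∷ w)      = cong (x ∷_) (flipLast-involutive w)

flipLast-≢ : ∀ {m} (w : Vec Bool (suc m)) → flipLast w ≢ w
flipLast-≢ {zero}  (false ∷ []) ()
flipLast-≢ {zero}  (true ∷ [])  ()
flipLast-≢ {suc m} (x ∷ w)      e = flipLast-≢ w (∷-injectiveʳ e)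

flipIf : ∀ {m} → Bool → Vec Bool (suc m) → Vec Bool (suc m)
flipIf i w = if i then flipLast w else w

flipIf-equivariant : ∀ {m} i → Equivariant (flipIf {m} i)
flipIf-equivariant false s  w = refl
flipIf-equivariant true  ga w = flipLast-a w
flipIf-equivariant true  gb w = flipLast-b w

flipIf-involutive : ∀ {m} i (w : Vec Bool (suc m)) → flipIf i (flipIf i w) ≡ w
flipIf-involutive false w = refl
flipIf-involutive true  w = flipLast-involutive w

flipIf-xor : ∀ {m} i j (w : Vec Bool (suc m)) → flipIf (i xor j) w ≡ flipIf i (flipIf j w)
flipIf-xor false j     w = refl
flipIf-xor true  false w = refl
flipIf-xor true  true  w = sym (flipLast-involutive w)

flipIf-injective : ∀ {m} {i j} (w : Vec Bool (suc m)) → flipIf i w ≡ flipIf j w → i ≡ j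
flipIf-injective {i = false} {false} w e = refl
flipIf-injective {i = false} {true}  w e with () ← flipLast-≢ w (sym e)
flipIf-injective {i = true}  {false} w e with () ← flipLast-≢ w e
flipIf-injective {i = true}  {true}  w e = refl

prefix-flipIf : ∀ {n} (p : n ≤ suc n) i (w : Vec Bool (suc n)) → prefix p (flipIf i w) ≡ prefix p w
prefix-flipIf p       false w       = refl
prefix-flipIf z≤n     true  w       = refl
prefix-flipIf (s≤s p) true  (x ∷ w) = cong (x ∷_) (prefix-flipIf p true w)

prefix-≡⇒flipIf : ∀ {n} (p : n ≤ suc n) (v w : Vec Bool (suc n)) →
  prefix p v ≡ prefix p w → ∃ λ i → v ≡ flipIf i w
prefix-≡⇒flipIf z≤n     (false ∷ []) (false ∷ []) _ = false , refl
prefix-≡⇒flipIf z≤n     (false ∷ []) (true ∷ [])  _ = true , refl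
prefix-≡⇒flipIf z≤n     (true ∷ [])  (false ∷ []) _ = true , refl
prefix-≡⇒flipIf z≤n     (true ∷ [])  (true ∷ [])  _ = false , refl
prefix-≡⇒flipIf (s≤s p) (x ∷ v)      (y ∷ w)      e with ∷-injective e
... | refl , e' with prefix-≡⇒flipIf p v w e'
...   | false , v≡w     = false , cong (x ∷_) v≡w
...   | true  , v≡flipw = true  , cong (x ∷_) v≡flipw

Z2⇒hasKDeck₂ : ∀ {G H} (π : Hom G H) → GalIsoZ2 π → HasKDeck 2 π
Z2⇒hasKDeck₂ π (φ , φ-injective , φ-onto , _) =
  (λ i → φ (to i)) ,
  (λ i j e → trans (sym (strictlyInverseʳ i)) (trans (cong from (φ-injective _ _ e)) (strictlyInverseʳ j))) ,
  λ τ → let i , τ≈φi = φ-onto τ in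
    from i , subst (λ x → DeckEq π τ (φ x)) (sym (strictlyInverseˡ i)) τ≈φi
  where open Inverse 2↔Bool

module _ {n} (p : n ≤ suc n) where

  0s : Vec Bool (suc n)
  0s = zeros (suc n)

  flipDeck : Bool → Deck (prefixHom p)
  flipDeck i = schreierHom (flipIf i) (flipIf-equivariant i) ,
    involution-isAuto (flipIf i) (flipIf-equivariant i) (flipIf-involutive i) ,
    ≈H-fromVertices (prefixHom p ∘H schreierHom (flipIf i) (flipIf-equivariant i)) (prefixHom p)
      (λ _ → refl) (λ _ → refl) (prefix-flipIf p i)

  deck-≈flipDeck : (τ : Deck (prefixHom p)) → ∃ λ i → DeckEq (prefixHom p) τ (flipDeck i)
  deck-≈flipDeck (σ , _ , over) with prefix-≡⇒flipIf p (fV σ 0s) 0s (proj₁ over 0s)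
  ... | i , σ0≡flip0 = i , ≈H-fromVertices σ (proj₁ (flipDeck i)) σ-lp (λ _ → refl)
          (equivariant-unique (fV σ) (flipIf i)
            (labelPreserving-equivariant σ σ-lp) (flipIf-equivariant i) σ0≡flip0)
    where
    σ-lp : LabelPreserving σ
    σ-lp = over-labelPreserving (prefix p) (prefix-equivariant p) σ over

  prefixHom-galIsoZ2 : GalIsoZ2 (prefixHom p)
  prefixHom-galIsoZ2 =
    flipDeck ,
    (λ i j (eqV , _) → flipIf-injective 0s (eqV 0s)) ,
    deck-≈flipDeck ,
    λ i j → ≈H-fromVertices (proj₁ (flipDeck (i xor j))) (proj₁ (flipDeck i) ∘H proj₁ (flipDeck j))
      (λ _ → refl) (λ _ → refl) (flipIf-xor i j)

mainTheorem4 :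
    ((m n : ℕ) → 1 ≤ n → (n<m : n < m) →
      Σ (Hom (Schreier m) (Schreier n)) λ π →
        (∀ w → fV π w ≡ prefix (<⇒≤ n<m) w) × IsCovering π)
    × ((n : ℕ) → 1 ≤ n →
      Σ (Hom (Schreier (suc n)) (Schreier n)) λ π →
        (∀ w → fV π w ≡ prefix (n≤1+n n) w) × IsGalois 2 π × GalIsoZ2 π)
mainTheorem4 =
  (λ m n _ n<m → prefixHom (<⇒≤ n<m) , (λ _ → refl) , prefixHom-isCovering (<⇒≤ n<m)) ,
  λ n _ → let p = n≤1+n n in
    prefixHom p , (λ _ → refl) ,
    (prefixHom-isCovering p , prefixHom-hasSheets₂ p , Z2⇒hasKDeck₂ (prefixHom p) (prefixHom-galIsoZ2 p)) ,
    prefixHom-galIsoZ2 p
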